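{- Let $P$ be a variable and let $B$ be a basic formula that is not a single variable and is not of the form $X\Rightarrow Y\lor W$ with $X,Y,W$ variables, and suppose $P$ occurs in $B$. Then there is a formula $C$ with fewer connective occurrences than $B$ such that $\mathbf{IPL}\vdash P\land B\Leftrightarrow P\land C$ and $C$ is either a basic formula, an atom (a variable, $\bot$ or $\top$), or a basic context that is a conjunction of two variables.
   Context: Formulas are built from propositional variables, constants $\bot,\top$ and connectives $\land,\lor,\Rightarrow$; $\lnot A$ abbreviates $A\Rightarrow\bot$ and $A\Leftrightarrow B$ abbreviates $(A\Rightarrow B)\land(B\Rightarrow A)$. $\mathbf{IPL}\vdash A$ means $A$ is provable in intuitionistic propositional logic. A formula is reduced if $\top$ does not occur as an operand of any connective and $\bot$ occurs as an operand only as the right-hand operand of $\Rightarrow$. A formula is basic if it is reduced and is either a variable or has the form $Q \Rightarrow D$ or $D \Rightarrow Q$ with $Q$ a variable and $D$ a formula containing at most one connective. A basic context is a reduced formula that is a conjunction of one or more pairwise distinct basic formulas. -}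

module Defs where

open import Data.Nat using (ℕ; zero; suc; _+_; _≤_)
open import Data.List using (List; []; _∷_; _++_)
open import Data.List.Membership.Propositional using (_∈_)
open import Data.List.Relation.Unary.All using (All)
open import Data.List.Relation.Unary.Unique.Propositional using (Unique)
open import Data.Product using (Σ; ∃; _×_; _,_)
open import Data.Sum using (_⊎_)
open import Data.Unit using () renaming (⊤ to Unit)
open import Data.Empty using () renaming (⊥ to Empty)
open import Relation.Binary.PropositionalEquality using (_≡_)

Var : Set
Var = ℕ

infixr 6 _∧_
infixr 5 _∨_
infixr 4 _⇒_

data Fm : Set where
  var     : Var → Fm
  ⊥f      : Fm
  ⊤f      : Fm
  _∧_     : Fm → Fm → Fm
  _∨_     : Fm → Fm → Fm
  _⇒_     : Fm → Fm → Fm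

¬f_ : Fm → Fm
¬f A = A ⇒ ⊥f

_⇔_ : Fm → Fm → Fm
A ⇔ B = (A ⇒ B) ∧ (B ⇒ A)

conn : Fm → ℕ
conn (var _) = 0
conn ⊥f = 0
conn ⊤f = 0
conn (A ∧ B) = suc (conn A + conn B)
conn (A ∨ B) = suc (conn A + conn B)
conn (A ⇒ B) = suc (conn A + conn B)

Occurs : Var → Fm → Set
Occurs P (var Q) = P ≡ Q
Occurs P ⊥f = Empty
Occurs P ⊤f = Empty
Occurs P (A ∧ B) = Occurs P A ⊎ Occurs P B
Occurs P (A ∨ B) = Occurs P A ⊎ Occurs P B
Occurs P (A ⇒ B) = Occurs P A ⊎ Occurs P B

infix 2 _⊢_
data _⊢_ (Γ : List Fm) : Fm → Set where
  hyp  : ∀ {A} → A ∈ Γ → Γ ⊢ A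
  ⊤I   : Γ ⊢ ⊤f
  ⊥E   : ∀ {A} → Γ ⊢ ⊥f → Γ ⊢ A
  ∧I   : ∀ {A B} → Γ ⊢ A → Γ ⊢ B → Γ ⊢ A ∧ B
  ∧E₁  : ∀ {A B} → Γ ⊢ A ∧ B → Γ ⊢ A
  ∧E₂  : ∀ {A B} → Γ ⊢ A ∧ B → Γ ⊢ B
  ∨I₁  : ∀ {A B} → Γ ⊢ A → Γ ⊢ A ∨ B
  ∨I₂  : ∀ {A B} → Γ ⊢ B → Γ ⊢ A ∨ B
  ∨E   : ∀ {A B C} → Γ ⊢ A ∨ B → (A ∷ Γ) ⊢ C → (B ∷ Γ) ⊢ C → Γ ⊢ C
  ⇒I   : ∀ {A B} → (A ∷ Γ) ⊢ B → Γ ⊢ A ⇒ B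
  ⇒E   : ∀ {A B} → Γ ⊢ A ⇒ B → Γ ⊢ A → Γ ⊢ B

IPL⊢ : Fm → Set
IPL⊢ A = [] ⊢ A

NotConst : Fm → Set
NotConst ⊥f = Empty
NotConst ⊤f = Empty
NotConst _ = Unit

NotTop : Fm → Set
NotTop ⊤f = Empty
NotTop _ = Unit

Reduced : Fm → Set
Reduced (var _) = Unit
Reduced ⊥f = Unit
Reduced ⊤f = Unit
Reduced (A ∧ B) = NotConst A × NotConst B × Reduced A × Reduced B
Reduced (A ∨ B) = NotConst A × NotConst B × Reduced A × Reduced B
Reduced (A ⇒ B) = NotConst A × NotTop B × Reduced A × Reduced B

IsVar : Fm → Set
IsVar F = ∃ λ X → F ≡ var X

IsAtom : Fm → Set
IsAtom F = IsVar F ⊎ (F ≡ ⊥f ⊎ F ≡ ⊤f)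

Basic : Fm → Set
Basic F = Reduced F ×
  (IsVar F ⊎ (Σ Var λ Q → Σ Fm λ D → conn D ≤ 1 × (F ≡ (var Q ⇒ D) ⊎ F ≡ (D ⇒ var Q))))

conjuncts : Fm → List Fm
conjuncts (A ∧ B) = conjuncts A ++ conjuncts B
conjuncts F = F ∷ []

BasicContext : Fm → Set
BasicContext F = Reduced F × All Basic (conjuncts F) × Unique (conjuncts F)

module Submission where

-- Work under the hypothesis P, i.e. in the context [ var P ].
-- There P is interchangeable with ⊤, and IPL equivalence is a congruence,
-- so every occurrence of P in the basic formula B may be replaced by ⊤ and
-- the result simplified with the usual ⊤/⊥ laws.  A basic formula has the
-- shape Q ⇒ D or D ⇒ Q with D "small" (at most one connective, ⊤-free).
--   * If P occurs in the small part D, then under P the formula D collapses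
--     either to ⊤ or to a strictly smaller variable or ⊥ (`residual`);
--     plugging this into Q ⇒ D or D ⇒ Q gives ⊤, Q, Q ⇒ A or A ⇒ Q.
--   * If P is the variable Q, then P ⇒ D reduces to D, which is basic, an
--     atom or a two-variable context once X ∧ X is contracted to X (the case
--     X ∨ Y is exactly the excluded one), while D ⇒ P reduces to ⊤.

open import Defs
open import Data.Nat using (_<_; _≤_; _≟_; z≤n; s≤s)
open import Data.Nat.Properties using (≤-refl; m+n≤o⇒m≤o; m+n≤o⇒n≤o; m≤n⇒m≤n+o)
open import Data.Product using (Σ; ∃; _×_; _,_)
open import Data.Sum using (_⊎_; inj₁; inj₂)
open import Data.Unit using (tt)
open import Data.Empty using (⊥-elim)
open import Data.List using (List; []; _∷_)
open import Data.List.Membership.Propositional using (_∈_)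
open import Data.List.Relation.Unary.Any using (here; there)
open import Data.List.Relation.Unary.All using ([]; _∷_)
open import Data.List.Relation.Unary.AllPairs using ([]; _∷_)
open import Data.List.Relation.Binary.Subset.Propositional using (_⊆_)
open import Data.List.Relation.Binary.Subset.Propositional.Properties
  using (∷⁺ʳ; xs⊆x∷xs)
open import Relation.Nullary using (¬_; yes; no)
open import Relation.Binary.PropositionalEquality using (_≡_; refl; cong)

weaken : ∀ {Γ Δ A} → Γ ⊆ Δ → Γ ⊢ A → Δ ⊢ A
weaken ρ (hyp x)    = hyp (ρ x)
weaken ρ ⊤I         = ⊤I
weaken ρ (⊥E d)     = ⊥E (weaken ρ d)
weaken ρ (∧I d e)   = ∧I (weaken ρ d) (weaken ρ e)
weaken ρ (∧E₁ d)    = ∧E₁ (weaken ρ d)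
weaken ρ (∧E₂ d)    = ∧E₂ (weaken ρ d)
weaken ρ (∨I₁ d)    = ∨I₁ (weaken ρ d)
weaken ρ (∨I₂ d)    = ∨I₂ (weaken ρ d)
weaken ρ (∨E d e f) = ∨E (weaken ρ d) (weaken (∷⁺ʳ _ ρ) e) (weaken (∷⁺ʳ _ ρ) f)
weaken ρ (⇒I d)     = ⇒I (weaken (∷⁺ʳ _ ρ) d)
weaken ρ (⇒E d e)   = ⇒E (weaken ρ d) (weaken ρ e)

weaken₁ : ∀ {Γ A B} → Γ ⊢ A → (B ∷ Γ) ⊢ A
weaken₁ = weaken (xs⊆x∷xs _ _)

v₀ : ∀ {Γ A} → (A ∷ Γ) ⊢ A
v₀ = hyp (here refl)

v₁ : ∀ {Γ A B} → (B ∷ A ∷ Γ) ⊢ A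
v₁ = hyp (there (here refl))

-- Equivalence in a context.  Since _⇔_ binds tighter than _⊢_,
-- `Γ ⊢ A ⇔ B` reads "A and B are IPL-equivalent under the hypotheses Γ";
-- it is introduced by deriving each side from the other.
⇔-intro : ∀ {Γ A B} → (A ∷ Γ) ⊢ B → (B ∷ Γ) ⊢ A → Γ ⊢ A ⇔ B
⇔-intro f g = ∧I (⇒I f) (⇒I g)

to : ∀ {Γ A B} → Γ ⊢ A ⇔ B → Γ ⊢ A → Γ ⊢ B
to e a = ⇒E (∧E₁ e) a

from : ∀ {Γ A B} → Γ ⊢ A ⇔ B → Γ ⊢ B → Γ ⊢ A
from e b = ⇒E (∧E₂ e) b

to₁ : ∀ {Γ A B C} → Γ ⊢ A ⇔ B → (C ∷ Γ) ⊢ A → (C ∷ Γ) ⊢ B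
to₁ e = to (weaken₁ e)

from₁ : ∀ {Γ A B C} → Γ ⊢ A ⇔ B → (C ∷ Γ) ⊢ B → (C ∷ Γ) ⊢ A
from₁ e = from (weaken₁ e)

to₂ : ∀ {Γ A B C D} → Γ ⊢ A ⇔ B → (D ∷ C ∷ Γ) ⊢ A → (D ∷ C ∷ Γ) ⊢ B
to₂ e = to (weaken₁ (weaken₁ e))

from₂ : ∀ {Γ A B C D} → Γ ⊢ A ⇔ B → (D ∷ C ∷ Γ) ⊢ B → (D ∷ C ∷ Γ) ⊢ A
from₂ e = from (weaken₁ (weaken₁ e))

⇔-refl : ∀ {Γ A} → Γ ⊢ A ⇔ A
⇔-refl = ⇔-intro v₀ v₀

⇔-trans : ∀ {Γ A B C} → Γ ⊢ A ⇔ B → Γ ⊢ B ⇔ C → Γ ⊢ A ⇔ C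
⇔-trans e f = ⇔-intro (to₁ f (to₁ e v₀)) (from₁ e (from₁ f v₀))

∧-cong : ∀ {Γ A A′ B B′} → Γ ⊢ A ⇔ A′ → Γ ⊢ B ⇔ B′ → Γ ⊢ (A ∧ B) ⇔ (A′ ∧ B′)
∧-cong e f = ⇔-intro (∧I (to₁ e (∧E₁ v₀)) (to₁ f (∧E₂ v₀)))
                     (∧I (from₁ e (∧E₁ v₀)) (from₁ f (∧E₂ v₀)))

∨-cong : ∀ {Γ A A′ B B′} → Γ ⊢ A ⇔ A′ → Γ ⊢ B ⇔ B′ → Γ ⊢ (A ∨ B) ⇔ (A′ ∨ B′)
∨-cong e f = ⇔-intro (∨E v₀ (∨I₁ (to₂ e v₀)) (∨I₂ (to₂ f v₀)))
                     (∨E v₀ (∨I₁ (from₂ e v₀)) (∨I₂ (from₂ f v₀)))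

⇒-cong : ∀ {Γ A A′ B B′} → Γ ⊢ A ⇔ A′ → Γ ⊢ B ⇔ B′ → Γ ⊢ (A ⇒ B) ⇔ (A′ ⇒ B′)
⇒-cong e f = ⇔-intro (⇒I (to₂ f (⇒E v₁ (from₂ e v₀))))
                     (⇒I (from₂ f (⇒E v₁ (to₂ e v₀))))

⊤⇒-law : ∀ {Γ A} → Γ ⊢ (⊤f ⇒ A) ⇔ A
⊤⇒-law = ⇔-intro (⇒E v₀ ⊤I) (⇒I v₁)

⇒⊤-law : ∀ {Γ A} → Γ ⊢ (A ⇒ ⊤f) ⇔ ⊤f
⇒⊤-law = ⇔-intro ⊤I (⇒I ⊤I)

⊥⇒-law : ∀ {Γ A} → Γ ⊢ (⊥f ⇒ A) ⇔ ⊤f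
⊥⇒-law = ⇔-intro ⊤I (⇒I (⊥E v₀))

⊤∧-law : ∀ {Γ A} → Γ ⊢ (⊤f ∧ A) ⇔ A
⊤∧-law = ⇔-intro (∧E₂ v₀) (∧I ⊤I v₀)

∧⊤-law : ∀ {Γ A} → Γ ⊢ (A ∧ ⊤f) ⇔ A
∧⊤-law = ⇔-intro (∧E₁ v₀) (∧I v₀ ⊤I)

⊤∨-law : ∀ {Γ A} → Γ ⊢ (⊤f ∨ A) ⇔ ⊤f
⊤∨-law = ⇔-intro ⊤I (∨I₁ ⊤I)

∨⊤-law : ∀ {Γ A} → Γ ⊢ (A ∨ ⊤f) ⇔ ⊤f
∨⊤-law = ⇔-intro ⊤I (∨I₂ ⊤I)

∧-idem : ∀ {Γ A} → Γ ⊢ (A ∧ A) ⇔ A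
∧-idem = ⇔-intro (∧E₁ v₀) (∧I v₀ v₀)

hyp-true : ∀ {Γ A} → A ∈ Γ → Γ ⊢ A ⇔ ⊤f
hyp-true x = ⇔-intro ⊤I (hyp (there x))

⟨_⟩ : Var → List Fm
⟨ P ⟩ = var P ∷ []

P-true : ∀ {P} → ⟨ P ⟩ ⊢ var P ⇔ ⊤f
P-true = hyp-true (here refl)

⇒P-true : ∀ {P D} → ⟨ P ⟩ ⊢ (D ⇒ var P) ⇔ ⊤f
⇒P-true = ⇔-trans (⇒-cong ⇔-refl P-true) ⇒⊤-law

conjoin : ∀ {P B C} → ⟨ P ⟩ ⊢ B ⇔ C → IPL⊢ ((var P ∧ B) ⇔ (var P ∧ C))
conjoin e = ⇔-intro (∧I (∧E₁ v₀) (to (underP e) (∧E₂ v₀)))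
                    (∧I (∧E₁ v₀) (from (underP e) (∧E₂ v₀)))
  where
  underP : ∀ {P A B C} → ⟨ P ⟩ ⊢ B ⇔ C → (var P ∧ A ∷ []) ⊢ B ⇔ C
  underP e = ⇒E (weaken (λ ()) (⇒I e)) (∧E₁ v₀)

-- Atoms other than ⊤: the right operands allowed by Reduced for ⇒.
data ProperAtom : Fm → Set where
  var-atom : ∀ X → ProperAtom (var X)
  ⊥-atom   : ProperAtom ⊥f

-- Reduced ⊤-free formulas with at most one connective: the formulas D
-- occurring in a basic Q ⇒ D or D ⇒ Q.
data Small : Fm → Set where
  atom : ∀ {A} → ProperAtom A → Small A
  conj : ∀ X Y → Small (var X ∧ var Y)
  disj : ∀ X Y → Small (var X ∨ var Y)
  impl : ∀ X {A} → ProperAtom A → Small (var X ⇒ A)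

operand-var : ∀ A → NotConst A → conn A ≤ 0 → ∃ λ X → A ≡ var X
operand-var (var X) _ _ = X , refl

operand-atom : ∀ A → NotTop A → conn A ≤ 0 → ProperAtom A
operand-atom (var X) _ _ = var-atom X
operand-atom ⊥f      _ _ = ⊥-atom

small : ∀ D → NotTop D → Reduced D → conn D ≤ 1 → Small D
small (var X) _ _ _ = atom (var-atom X)
small ⊥f      _ _ _ = atom ⊥-atom
small (A ∧ E) _ (ncA , ncE , _) (s≤s c)
  with operand-var A ncA (m+n≤o⇒m≤o (conn A) c) | operand-var E ncE (m+n≤o⇒n≤o (conn A) c)
... | X , refl | Y , refl = conj X Y
small (A ∨ E) _ (ncA , ncE , _) (s≤s c)
  with operand-var A ncA (m+n≤o⇒m≤o (conn A) c) | operand-var E ncE (m+n≤o⇒n≤o (conn A) c)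
... | X , refl | Y , refl = disj X Y
small (A ⇒ E) _ (ncA , ntE , _) (s≤s c)
  with operand-var A ncA (m+n≤o⇒m≤o (conn A) c)
... | X , refl = impl X (operand-atom E ntE (m+n≤o⇒n≤o (conn A) c))

notConst⇒notTop : ∀ D → NotConst D → NotTop D
notConst⇒notTop (var _) _ = tt
notConst⇒notTop (_ ∧ _) _ = tt
notConst⇒notTop (_ ∨ _) _ = tt
notConst⇒notTop (_ ⇒ _) _ = tt

Target : Fm → Set
Target C = Basic C ⊎ (IsAtom C ⊎ (BasicContext C × (Σ Var λ X → Σ Var λ Y → C ≡ (var X ∧ var Y))))

record Simplification (P : Var) (B : Fm) : Set where
  constructor simplifies-to
  field
    C          : Fm
    smaller    : conn C < conn B
    equivalent : ⟨ P ⟩ ⊢ B ⇔ C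
    shaped     : Target C

basic-var : ∀ X → Target (var X)
basic-var X = inj₁ (tt , inj₁ (X , refl))

basic-premise : ∀ Q {A} → ProperAtom A → Target (var Q ⇒ A)
basic-premise Q (var-atom Y) = inj₁ ((tt , tt , tt , tt) , inj₂ (Q , var Y , z≤n , inj₁ refl))
basic-premise Q ⊥-atom       = inj₁ ((tt , tt , tt , tt) , inj₂ (Q , ⊥f , z≤n , inj₁ refl))

basic-conclusion : ∀ Y Q → Target (var Y ⇒ var Q)
basic-conclusion Y Q = inj₁ ((tt , tt , tt , tt) , inj₂ (Q , var Y , z≤n , inj₂ refl))

top-target : Target ⊤f
top-target = inj₂ (inj₁ (inj₂ (inj₂ refl)))

bot-target : Target ⊥f
bot-target = inj₂ (inj₁ (inj₂ (inj₁ refl)))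

two-variable-context : ∀ {X Y} → ¬ X ≡ Y → Target (var X ∧ var Y)
two-variable-context {X} {Y} X≢Y =
  inj₂ (inj₂ (((tt , tt , tt , tt) , (tt , inj₁ (X , refl)) ∷ (tt , inj₁ (Y , refl)) ∷ [] ,
               (distinct ∷ []) ∷ [] ∷ []) , X , Y , refl))
  where
  distinct : ¬ var X ≡ var Y
  distinct refl = X≢Y refl

data Residual (P : Var) (D : Fm) : Set where
  vanishes : ⟨ P ⟩ ⊢ D ⇔ ⊤f → Residual P D
  reduces  : ∀ {A} → ProperAtom A → conn A < conn D → ⟨ P ⟩ ⊢ D ⇔ A → Residual P D

-- Replace P by ⊤ and simplify.
residual : ∀ {P D} → Small D → Occurs P D → Residual P D
residual (atom (var-atom _)) refl = vanishes P-true
residual (atom ⊥-atom) ()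
residual (conj _ Y) (inj₁ refl) = reduces (var-atom Y) (s≤s z≤n) (⇔-trans (∧-cong P-true ⇔-refl) ⊤∧-law)
residual (conj X _) (inj₂ refl) = reduces (var-atom X) (s≤s z≤n) (⇔-trans (∧-cong ⇔-refl P-true) ∧⊤-law)
residual (disj _ _) (inj₁ refl) = vanishes (⇔-trans (∨-cong P-true ⇔-refl) ⊤∨-law)
residual (disj _ _) (inj₂ refl) = vanishes (⇔-trans (∨-cong ⇔-refl P-true) ∨⊤-law)
residual (impl _ a) (inj₁ refl) = reduces a ≤-refl (⇔-trans (⇒-cong P-true ⇔-refl) ⊤⇒-law)
residual (impl _ (var-atom _)) (inj₂ refl) = vanishes ⇒P-true
residual (impl _ ⊥-atom) (inj₂ ())

-- The excluded basic formulas X ⇒ Y ∨ W are those with disjunctive D.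
NotDisjunction : Fm → Set
NotDisjunction D = ¬ (Σ Var λ Y → Σ Var λ W → D ≡ (var Y ∨ var W))

-- A small non-disjunction is, up to equivalence, already admissible:
-- only X ∧ X needs contracting to X.
small-target : ∀ {D} → Small D → NotDisjunction D →
  Σ Fm λ C → conn C ≤ conn D × (∀ {Γ} → Γ ⊢ D ⇔ C) × Target C
small-target (atom (var-atom X)) _ = var X , z≤n , ⇔-refl , basic-var X
small-target (atom ⊥-atom)       _ = ⊥f , z≤n , ⇔-refl , bot-target
small-target (conj X Y) _ with X ≟ Y
... | yes refl = var X , z≤n , ∧-idem , basic-var X
... | no X≢Y   = (var X ∧ var Y) , ≤-refl , ⇔-refl , two-variable-context X≢Y
small-target (disj X Y) ¬disj = ⊥-elim (¬disj (X , Y , refl))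
small-target (impl X a) _ = (var X ⇒ _) , ≤-refl , ⇔-refl , basic-premise X a

-- B = Q ⇒ D: if P is Q, drop the true premise; otherwise replace D by its
-- residual, and Q ⇒ ⊤ collapses to ⊤.
simplify-premise : ∀ {P} Q {D} → Small D → NotDisjunction D →
  Occurs P (var Q ⇒ D) → Simplification P (var Q ⇒ D)
simplify-premise Q s ¬disj (inj₁ refl) with small-target s ¬disj
... | C , c≤ , e , t =
  simplifies-to C (s≤s c≤) (⇔-trans (⇔-trans (⇒-cong P-true ⇔-refl) ⊤⇒-law) e) t
simplify-premise Q s _ (inj₂ occ) with residual s occ
... | vanishes e = simplifies-to ⊤f (s≤s z≤n) (⇔-trans (⇒-cong ⇔-refl e) ⇒⊤-law) top-target
... | reduces a c< e = simplifies-to (var Q ⇒ _) (s≤s c<) (⇒-cong ⇔-refl e) (basic-premise Q a)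

-- B = D ⇒ Q: if P is Q, B is true; otherwise replace D by its residual A,
-- and ⊤ ⇒ Q, ⊥ ⇒ Q collapse to Q, ⊤ respectively.
simplify-conclusion : ∀ {P} Q {D} → Small D → Occurs P (D ⇒ var Q) → Simplification P (D ⇒ var Q)
simplify-conclusion Q _ (inj₂ refl) = simplifies-to ⊤f (s≤s z≤n) ⇒P-true top-target
simplify-conclusion Q s (inj₁ occ) with residual s occ
... | vanishes e = simplifies-to (var Q) (s≤s z≤n) (⇔-trans (⇒-cong e ⇔-refl) ⊤⇒-law) (basic-var Q)
... | reduces (var-atom Y) c< e =
  simplifies-to (var Y ⇒ var Q) (s≤s (m≤n⇒m≤n+o 0 c<)) (⇒-cong e ⇔-refl) (basic-conclusion Y Q)
... | reduces ⊥-atom _ e =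
  simplifies-to ⊤f (s≤s z≤n) (⇔-trans (⇒-cong e ⇔-refl) ⊥⇒-law) top-target

simplify-basic : ∀ P B → Basic B → ¬ IsVar B →
  ¬ (Σ Var λ X → Σ Var λ Y → Σ Var λ W → B ≡ (var X ⇒ (var Y ∨ var W))) →
  Occurs P B → Simplification P B
simplify-basic P _ (_ , inj₁ (X , refl)) ¬var _ _ = ⊥-elim (¬var (X , refl))
simplify-basic P _ ((_ , ntD , _ , rD) , inj₂ (Q , D , c , inj₁ refl)) _ ¬disj occ =
  simplify-premise Q (small D ntD rD c) (λ (Y , W , D≡) → ¬disj (Q , Y , W , cong (var Q ⇒_) D≡)) occ
simplify-basic P _ ((ncD , _ , rD , _) , inj₂ (Q , D , c , inj₂ refl)) _ _ occ =
  simplify-conclusion Q (small D (notConst⇒notTop D ncD) rD c) occ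

lemma4 : (P : Var) (B : Fm) → Basic B → ¬ IsVar B →
    ¬ (Σ Var λ X → Σ Var λ Y → Σ Var λ W → B ≡ (var X ⇒ (var Y ∨ var W))) →
    Occurs P B →
    Σ Fm λ C → conn C < conn B × IPL⊢ ((var P ∧ B) ⇔ (var P ∧ C)) ×
    (Basic C ⊎ (IsAtom C ⊎ (BasicContext C × (Σ Var λ X → Σ Var λ Y → C ≡ (var X ∧ var Y)))))
lemma4 P B basic ¬var ¬disj occ with simplify-basic P B basic ¬var ¬disj occ
... | simplifies-to C c< e t = C , c< , conjoin e , t
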